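{- Let $S$ be a sorting sequence of length $p$ with $r>1$ distinct values and multiplicities $p_1,\dots,p_r$, and let $c=\gcd(p_1,\dots,p_r)$. Let $\gamma$ be the minimal integer divisible by $c$ such that for every integer $f>\gamma$ divisible by $c$ there exists a general solution for $S$ with $f$ fake coins, and let $\gamma'$ be the analogous integer for the reverse sequence $S'$. Then, whenever the pile size $k$ satisfies $k\ge (4p-2p_1-2p_r)/c+1-r$, for every integer $f$ divisible by $c$ with $\gamma<f<pk-\gamma'$ there exists a general solution for $S$ with $f$ fake coins satisfying the height bound for $k$ (i.e. there can be $f$ fake coins).
   Context: There are $pk$ labelled coins arranged in $p$ piles of $k$ coins; each coin is real or fake, real coins all have one weight and fake coins all have one smaller weight. The sorting strategy sorts the piles by weight. A sorting sequence of length $p$ is a non-decreasing sequence of $p$ non-negative integers beginning with $0$ in which each entry equals the previous one or exceeds it by $1$; it records the outcome of the sorting (piles listed heaviest to lightest; equal-weight piles get equal entries, a strictly lighter pile gets an entry one larger). If the distinct entries are $0,1,\dots,r-1$, let $p_i\ge 1$ be the number of entries equal to $i-1$ ($i=1,\dots,r$), so $p_1+\dots+p_r=p$. A general solution for the sorting sequence with $f$ fake coins is an integer tuple $(f_1,\dots,f_r)$ with $0\le f_1<f_2<\dots<f_r$ and $p_1f_1+\dots+p_rf_r=f$ ($f_i$ is the number of fake coins in each pile marked $i-1$); it satisfies the height bound for $k$ if $f_r\le k$. The reverse sequence $S'$ is the sorting sequence of length $p$ with $r$ distinct values in which the number of entries equal to $i-1$ is $p_{r-i+1}$. -}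

module Defs where

open import Data.Nat using (ℕ; zero; suc; _+_; _*_; _∸_; _≤_; _<_)
open import Data.Nat.GCD using (gcd)
open import Data.Nat.Divisibility using (_∣_)
open import Data.Fin using (Fin; toℕ)
open import Data.Vec using (Vec; []; _∷_; lookup; zipWith; sum; foldr; last; head; reverse)
open import Data.Product using (Σ; _×_)
open import Relation.Binary.PropositionalEquality using (_≡_)

-- A sorting sequence with r distinct values is encoded by its multiplicity
-- vector (p₁,…,p_r), all pᵢ ≥ 1 (the sequence 0^{p₁} 1^{p₂} … (r-1)^{p_r}
-- is uniquely determined by it, and every such vector arises).
Multiplicities : ℕ → Set
Multiplicities r = Vec ℕ r

ValidMultiplicities : {r : ℕ} → Multiplicities r → Set
ValidMultiplicities {r} ps = (i : Fin r) → 1 ≤ lookup ps i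

seqLength : {r : ℕ} → Multiplicities r → ℕ
seqLength ps = sum ps

gcdVec : {r : ℕ} → Vec ℕ r → ℕ
gcdVec = foldr (λ _ → ℕ) gcd 0

-- The reverse sequence S' has multiplicities (p_r,…,p₁).
reverseSeq : {r : ℕ} → Multiplicities r → Multiplicities r
reverseSeq = reverse

StrictlyIncreasing : {r : ℕ} → Vec ℕ r → Set
StrictlyIncreasing {r} fs = (i j : Fin r) → toℕ i < toℕ j → lookup fs i < lookup fs j

IsGeneralSolution : {r : ℕ} → Multiplicities r → ℕ → Vec ℕ r → Set
IsGeneralSolution ps f fs = StrictlyIncreasing fs × sum (zipWith _*_ ps fs) ≡ f

HasGeneralSolution : {r : ℕ} → Multiplicities r → ℕ → Set
HasGeneralSolution {r} ps f = Σ (Vec ℕ r) (λ fs → IsGeneralSolution ps f fs)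

HeightBound : {m : ℕ} → ℕ → Vec ℕ (suc m) → Set
HeightBound k fs = last fs ≤ k

HasBoundedGeneralSolution : {m : ℕ} → Multiplicities (suc m) → ℕ → ℕ → Set
HasBoundedGeneralSolution {m} ps k f =
  Σ (Vec ℕ (suc m)) (λ fs → IsGeneralSolution ps f fs × HeightBound k fs)

GammaProperty : {r : ℕ} → Multiplicities r → ℕ → Set
GammaProperty ps γ = (f : ℕ) → gcdVec ps ∣ f → γ < f → HasGeneralSolution ps f

-- γ is the minimal integer divisible by c with the γ-property.
-- (Since f = 0 admits no general solution when r > 1, this minimum is ≥ 0,
-- so it may be taken in ℕ.)
IsGamma : {r : ℕ} → Multiplicities r → ℕ → Set
IsGamma ps γ =
  gcdVec ps ∣ γ × GammaProperty ps γ
  × ((δ : ℕ) → gcdVec ps ∣ δ → GammaProperty ps δ → γ ≤ δ)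

-- Dividing every multiplicity by c reduces to c = 1; let P = p₁ + … + p_r. A general solution is
-- described by its gaps d₁ = f₁ and dᵢ₊₁ = fᵢ₊₁ − fᵢ − 1: the number of fake coins is P d₁ plus the
-- later gaps weighted by suffix sums of the pᵢ, plus a constant. Viewing the later gaps as units,
-- two of the P + 1 initial segments of masses 0, …, P have congruent weights modulo P; cutting out
-- the units between them and adding the quotient to d₁ keeps the value. So one may assume the
-- later gaps total less than P, which bounds the height f_r. Take such solutions for f and, for
-- the reverse sequence, for Pk − f (both exist since f > γ and Pk − f > γ'). If the first has
-- height at most k we are done; if the second has, g ↦ k − g read backwards is a solution for f.
-- If both are taller than k, adding the two height bounds contradicts the lower bound on k.

module Submission where

open import Defs
open import Data.Nat using (ℕ; suc; _+_; _*_; _∸_; _≤_; _<_)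
open import Data.Nat.Divisibility using (_∣_)
open import Data.Vec using (Vec; head; last)

open import Data.Empty using (⊥; ⊥-elim)
open import Data.Fin using (toℕ; fromℕ<; zero; suc)
open import Data.Fin.Properties using (pigeonhole; toℕ-fromℕ<; toℕ<n)
open import Data.Nat using (zero; z≤n; s≤s; z<s; s<s; _⊓_; _>_; NonZero; >-nonZero; ≢-nonZero⁻¹; _≤?_)
open import Data.Nat.DivMod using (_/_; _%_; m≡m%n+[m/n]*n; m%n<n; /-monoˡ-≤)
open import Data.Nat.Divisibility using (divides; ∣-trans; _∣0; 0∣⇒≡0)
open import Data.Nat.GCD using (gcd[m,n]∣m; gcd[m,n]∣n; gcd-greatest)
open import Data.Nat.Induction using (<-wellFounded)
open import Data.Nat.Properties
open import Algebra.Properties.CommutativeSemigroup +-commutativeSemigroup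
  using (interchange) renaming (xy∙z≈xz∙y to +-right-comm)
open import Algebra.Properties.CommutativeSemigroup *-commutativeSemigroup
  using () renaming (xy∙z≈xz∙y to *-right-comm)
open import Data.Nat.Tactic.RingSolver using (solve-∀)
open import Data.Product using (∃; _×_; _,_; proj₁; proj₂)
open import Data.Sum using (inj₁; inj₂)
open import Data.Vec using ([]; _∷_; _∷ʳ_; zipWith; sum; map; reverse; tail; replicate)
open import Data.Vec.Properties using (reverse-∷; reverse-involutive; last-reverse; map-reverse)
open import Data.Vec.Relation.Unary.All using (All; []; _∷_)
import Data.Vec.Relation.Unary.All as All
import Data.Vec.Relation.Unary.All.Properties as All
open import Data.Vec.Relation.Unary.Linked using (Linked; []; [-]; _∷_)
open import Data.Vec.Relation.Unary.Linked.Properties using (Linked⇒All; lookup⁺)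
open import Function using (flip)
open import Induction.WellFounded using (Acc; acc)
open import Relation.Binary.PropositionalEquality
open import Relation.Nullary using (yes; no; contradiction)

private variable n : ℕ

infix 7 _·_

_·_ : Vec ℕ n → Vec ℕ n → ℕ
a · b = sum (zipWith _*_ a b)

sum-∷ʳ : (xs : Vec ℕ n) (y : ℕ) → sum (xs ∷ʳ y) ≡ sum xs + y
sum-∷ʳ []       y = +-identityʳ y
sum-∷ʳ (x ∷ xs) y = trans (cong (x +_) (sum-∷ʳ xs y)) (sym (+-assoc x (sum xs) y))

sum-reverse : (v : Vec ℕ n) → sum (reverse v) ≡ sum v
sum-reverse []      = refl
sum-reverse (x ∷ v) = begin
  sum (reverse (x ∷ v)) ≡⟨ cong sum (reverse-∷ x v) ⟩
  sum (reverse v ∷ʳ x)  ≡⟨ sum-∷ʳ (reverse v) x ⟩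
  sum (reverse v) + x   ≡⟨ cong (_+ x) (sum-reverse v) ⟩
  sum v + x             ≡⟨ +-comm (sum v) x ⟩
  x + sum v             ∎
  where open ≡-Reasoning

sum-head-tail : (v : Vec ℕ (suc n)) → sum v ≡ head v + sum (tail v)
sum-head-tail (x ∷ v) = refl

sum-reverse-split : (v : Vec ℕ (suc n)) → sum (reverse v) ≡ sum (tail v) + last (reverse v)
sum-reverse-split (x ∷ v) = begin
  sum (reverse (x ∷ v))          ≡⟨ sum-reverse (x ∷ v) ⟩
  x + sum v                      ≡⟨ +-comm x (sum v) ⟩
  sum v + x                      ≡⟨ cong (sum v +_) (last-reverse (x ∷ v)) ⟨
  sum v + last (reverse (x ∷ v)) ∎
  where open ≡-Reasoning

last≤sum : (v : Vec ℕ (suc n)) → last v ≤ sum v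
last≤sum (x ∷ [])    = m≤m+n x 0
last≤sum (x ∷ y ∷ v) = ≤-trans (last≤sum (y ∷ v)) (m≤n+m _ x)

last-map : (f : ℕ → ℕ) (v : Vec ℕ (suc n)) → last (map f v) ≡ f (last v)
last-map f (x ∷ [])    = refl
last-map f (x ∷ y ∷ v) = last-map f (y ∷ v)

sum-map-* : (c : ℕ) (v : Vec ℕ n) → sum (map (_* c) v) ≡ sum v * c
sum-map-* c []      = refl
sum-map-* c (x ∷ v) = trans (cong (x * c +_) (sum-map-* c v)) (sym (*-distribʳ-+ c x (sum v)))

map-*-· : (c : ℕ) (a b : Vec ℕ n) → map (_* c) a · b ≡ (a · b) * c
map-*-· c []      []      = refl
map-*-· c (x ∷ a) (y ∷ b) = trans (cong (x * c * y +_) (map-*-· c a b)) (rearrange x c y (a · b))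
  where
  rearrange : ∀ x c y e → x * c * y + e * c ≡ (x * y + e) * c
  rearrange = solve-∀

replicate-1-· : (v : Vec ℕ n) → replicate n 1 · v ≡ sum v
replicate-1-· []      = refl
replicate-1-· (x ∷ v) = cong₂ _+_ (*-identityˡ x) (replicate-1-· v)

zipWith-∷ʳ : (f : ℕ → ℕ → ℕ) (xs ys : Vec ℕ n) (x y : ℕ) →
             zipWith f (xs ∷ʳ x) (ys ∷ʳ y) ≡ zipWith f xs ys ∷ʳ f x y
zipWith-∷ʳ f []       []       x y = refl
zipWith-∷ʳ f (a ∷ xs) (b ∷ ys) x y = cong (f a b ∷_) (zipWith-∷ʳ f xs ys x y)

zipWith-reverse : (f : ℕ → ℕ → ℕ) (a b : Vec ℕ n) →
                  zipWith f (reverse a) (reverse b) ≡ reverse (zipWith f a b)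
zipWith-reverse f []      []      = refl
zipWith-reverse f (x ∷ a) (y ∷ b) = begin
  zipWith f (reverse (x ∷ a)) (reverse (y ∷ b)) ≡⟨ cong₂ (zipWith f) (reverse-∷ x a) (reverse-∷ y b) ⟩
  zipWith f (reverse a ∷ʳ x) (reverse b ∷ʳ y)   ≡⟨ zipWith-∷ʳ f (reverse a) (reverse b) x y ⟩
  zipWith f (reverse a) (reverse b) ∷ʳ f x y    ≡⟨ cong (_∷ʳ f x y) (zipWith-reverse f a b) ⟩
  reverse (zipWith f a b) ∷ʳ f x y              ≡⟨ reverse-∷ (f x y) (zipWith f a b) ⟨
  reverse (zipWith f (x ∷ a) (y ∷ b))           ∎
  where open ≡-Reasoning

·-reverse : (a b : Vec ℕ n) → a · reverse b ≡ reverse a · b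
·-reverse a b = begin
  a · reverse b                     ≡⟨ cong (_· reverse b) (reverse-involutive a) ⟨
  reverse (reverse a) · reverse b   ≡⟨ cong sum (zipWith-reverse _*_ (reverse a) b) ⟩
  sum (reverse (zipWith _*_ (reverse a) b)) ≡⟨ sum-reverse (zipWith _*_ (reverse a) b) ⟩
  reverse a · b                     ∎
  where open ≡-Reasoning

·-complement : (k : ℕ) (a v : Vec ℕ n) → All (_≤ k) v → a · map (k ∸_) v + a · v ≡ k * sum a
·-complement k []      []      []           = sym (*-zeroʳ k)
·-complement k (a ∷ as) (x ∷ v) (x≤k ∷ v≤k) = begin
  a * (k ∸ x) + as · map (k ∸_) v + (a * x + as · v)   ≡⟨ interchange (a * (k ∸ x)) _ (a * x) _ ⟩
  (a * (k ∸ x) + a * x) + (as · map (k ∸_) v + as · v) ≡⟨ cong₂ _+_ (sym (*-distribˡ-+ a (k ∸ x) x)) (·-complement k as v v≤k) ⟩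
  a * (k ∸ x + x) + k * sum as                         ≡⟨ cong (λ z → a * z + k * sum as) (m∸n+n≡m x≤k) ⟩
  a * k + k * sum as                                   ≡⟨ cong (_+ k * sum as) (*-comm a k) ⟩
  k * a + k * sum as                                   ≡⟨ *-distribˡ-+ k a (sum as) ⟨
  k * (a + sum as)                                     ∎
  where open ≡-Reasoning

All-∷ʳ : {P : ℕ → Set} {xs : Vec ℕ n} {y : ℕ} → All P xs → P y → All P (xs ∷ʳ y)
All-∷ʳ []         py = py ∷ []
All-∷ʳ (px ∷ pxs) py = px ∷ All-∷ʳ pxs py

All-reverse : {P : ℕ → Set} {xs : Vec ℕ n} → All P xs → All P (reverse xs)
All-reverse {xs = []}               []         = []
All-reverse {P = P} {xs = x ∷ xs} (px ∷ pxs) =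
  subst (All P) (sym (reverse-∷ x xs)) (All-∷ʳ (All-reverse pxs) px)

All-tail : {P : ℕ → Set} {xs : Vec ℕ (suc n)} → All P xs → All P (tail xs)
All-tail {xs = _ ∷ _} (_ ∷ pxs) = pxs

positive⇒length≤sum : {v : Vec ℕ n} → All (1 ≤_) v → n ≤ sum v
positive⇒length≤sum []         = z≤n
positive⇒length≤sum (1≤x ∷ ps) = +-mono-≤ 1≤x (positive⇒length≤sum ps)

Linked-∷ʳ : {R : ℕ → ℕ → Set} {xs : Vec ℕ (suc n)} {y : ℕ} →
            Linked R xs → R (last xs) y → Linked R (xs ∷ʳ y)
Linked-∷ʳ {xs = x ∷ []}     [-]       r = r ∷ [-]
Linked-∷ʳ {xs = x ∷ x' ∷ xs} (r' ∷ lk) r = r' ∷ Linked-∷ʳ lk r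

Linked-reverse : {R : ℕ → ℕ → Set} {xs : Vec ℕ n} → Linked (flip R) xs → Linked R (reverse xs)
Linked-reverse {xs = []}         []       = []
Linked-reverse {xs = x ∷ []}     [-]      = [-]
Linked-reverse {R = R} {xs = x ∷ y ∷ xs} (r ∷ lk) =
  subst (Linked R) (sym (reverse-∷ x (y ∷ xs)))
    (Linked-∷ʳ (Linked-reverse lk) (subst (λ z → R z x) (sym (last-reverse (y ∷ xs))) r))

linked-≤-last : {k : ℕ} {xs : Vec ℕ (suc n)} → Linked _<_ xs → last xs ≤ k → All (_≤ k) xs
linked-≤-last {xs = x ∷ []}    [-]        x≤k = x≤k ∷ []
linked-≤-last {xs = x ∷ y ∷ _} (x<y ∷ lk) l≤k with y≤k ∷ rest ← linked-≤-last lk l≤k =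
  ≤-trans (<⇒≤ x<y) y≤k ∷ y≤k ∷ rest

complement-linked : {k : ℕ} {xs : Vec ℕ n} → All (_≤ k) xs → Linked _<_ xs → Linked _>_ (map (k ∸_) xs)
complement-linked []               []         = []
complement-linked (_ ∷ [])         [-]        = [-]
complement-linked (_ ∷ y≤k ∷ ys≤k) (x<y ∷ lk) = ∸-monoʳ-< x<y y≤k ∷ complement-linked (y≤k ∷ ys≤k) lk

strictlyIncreasing⇒linked : (fs : Vec ℕ n) → StrictlyIncreasing fs → Linked _<_ fs
strictlyIncreasing⇒linked []          _  = []
strictlyIncreasing⇒linked (x ∷ [])    _  = [-]
strictlyIncreasing⇒linked (x ∷ y ∷ v) si =
  si zero (suc zero) z<s ∷ strictlyIncreasing⇒linked (y ∷ v) (λ i j i<j → si (suc i) (suc j) (s<s i<j))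

linked⇒strictlyIncreasing : {fs : Vec ℕ n} → Linked _<_ fs → StrictlyIncreasing fs
linked⇒strictlyIncreasing lk i j = lookup⁺ <-trans lk

-- Gap coordinates of strictly increasing vectors

fromGaps : ℕ → Vec ℕ n → Vec ℕ n
fromGaps o []       = []
fromGaps o (d ∷ ds) = (o + d) ∷ fromGaps (suc (o + d)) ds

fromGaps-linked : (o : ℕ) (ds : Vec ℕ n) → Linked _<_ (fromGaps o ds)
fromGaps-linked o []            = []
fromGaps-linked o (d ∷ [])      = [-]
fromGaps-linked o (d ∷ d' ∷ ds) = s≤s (m≤m+n (o + d) d') ∷ fromGaps-linked (suc (o + d)) (d' ∷ ds)

linked⇒fromGaps : (o : ℕ) (xs : Vec ℕ n) → All (o ≤_) xs → Linked _<_ xs →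
                  ∃ λ ds → fromGaps o ds ≡ xs
linked⇒fromGaps o []           []          []  = [] , refl
linked⇒fromGaps o (x ∷ [])     (o≤x ∷ [])  [-] = (x ∸ o) ∷ [] , cong (_∷ []) (m+[n∸m]≡n o≤x)
linked⇒fromGaps o (x ∷ y ∷ xs) (o≤x ∷ _) (x<y ∷ ys<)
  with ds , eq ← linked⇒fromGaps (suc x) (y ∷ xs) (Linked⇒All <-trans x<y ys<) ys<
  = (x ∸ o) ∷ ds , trans (cong (λ z → z ∷ fromGaps (suc z) ds) (m+[n∸m]≡n o≤x)) (cong (x ∷_) eq)

last-fromGaps : (o : ℕ) (ds : Vec ℕ (suc n)) → last (fromGaps o ds) ≡ o + sum ds + n
last-fromGaps {zero}  o (d ∷ [])      = sym (trans (+-identityʳ _) (cong (o +_) (+-identityʳ d)))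
last-fromGaps {suc n} o (d ∷ d' ∷ ds) =
  trans (last-fromGaps (suc (o + d)) (d' ∷ ds)) (rearrange o d (d' + sum ds) n)
  where
  rearrange : ∀ o d s n → suc (o + d) + s + n ≡ o + (d + s) + suc n
  rearrange = solve-∀

suffixSums : Vec ℕ n → Vec ℕ n
suffixSums []       = []
suffixSums (q ∷ qs) = (q + sum qs) ∷ suffixSums qs

-- baseValue qs = qs · (0, 1, …, n − 1), the value of the lowest strictly increasing vector.
baseValue : Vec ℕ n → ℕ
baseValue []       = 0
baseValue (q ∷ qs) = sum qs + baseValue qs

·-fromGaps : (o : ℕ) (qs ds : Vec ℕ n) →
             qs · fromGaps o ds ≡ o * sum qs + suffixSums qs · ds + baseValue qs
·-fromGaps o []       []       = zero-case o
  where
  zero-case : ∀ o → 0 ≡ o * 0 + 0 + 0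
  zero-case = solve-∀
·-fromGaps o (q ∷ qs) (d ∷ ds) = begin
  q * (o + d) + qs · fromGaps (suc (o + d)) ds
    ≡⟨ cong (q * (o + d) +_) (·-fromGaps (suc (o + d)) qs ds) ⟩
  q * (o + d) + (suc (o + d) * sum qs + suffixSums qs · ds + baseValue qs)
    ≡⟨ rearrange q o d (sum qs) (suffixSums qs · ds) (baseValue qs) ⟩
  o * (q + sum qs) + ((q + sum qs) * d + suffixSums qs · ds) + (sum qs + baseValue qs) ∎
  where
  open ≡-Reasoning
  rearrange : ∀ q o d s e b → q * (o + d) + (suc (o + d) * s + e + b) ≡ o * (q + s) + ((q + s) * d + e) + (s + b)
  rearrange = solve-∀

baseValue-∷ʳ : (xs : Vec ℕ n) (y : ℕ) → baseValue (xs ∷ʳ y) ≡ baseValue xs + n * y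
baseValue-∷ʳ []       y = refl
baseValue-∷ʳ {suc n} (x ∷ xs) y =
  trans (cong₂ _+_ (sum-∷ʳ xs y) (baseValue-∷ʳ xs y)) (rearrange (sum xs) y (baseValue xs) n)
  where
  rearrange : ∀ s y b n → s + y + (b + n * y) ≡ s + b + suc n * y
  rearrange = solve-∀

baseValue-reverse : (v : Vec ℕ (suc n)) → baseValue v + baseValue (reverse v) ≡ n * sum v
baseValue-reverse {zero}  (x ∷ [])  = refl
baseValue-reverse {suc n} (x ∷ xs) = begin
  sum xs + baseValue xs + baseValue (reverse (x ∷ xs))
    ≡⟨ cong (λ z → sum xs + baseValue xs + baseValue z) (reverse-∷ x xs) ⟩
  sum xs + baseValue xs + baseValue (reverse xs ∷ʳ x)
    ≡⟨ cong (sum xs + baseValue xs +_) (baseValue-∷ʳ (reverse xs) x) ⟩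
  sum xs + baseValue xs + (baseValue (reverse xs) + suc n * x)
    ≡⟨ +-assoc (sum xs + baseValue xs) (baseValue (reverse xs)) (suc n * x) ⟨
  sum xs + baseValue xs + baseValue (reverse xs) + suc n * x
    ≡⟨ cong (_+ suc n * x) (+-assoc (sum xs) (baseValue xs) (baseValue (reverse xs))) ⟩
  sum xs + (baseValue xs + baseValue (reverse xs)) + suc n * x
    ≡⟨ cong (λ z → sum xs + z + suc n * x) (baseValue-reverse xs) ⟩
  sum xs + n * sum xs + suc n * x
    ≡⟨ rearrange (sum xs) n x ⟩
  suc n * (x + sum xs) ∎
  where
  open ≡-Reasoning
  rearrange : ∀ s n x → s + n * s + suc n * x ≡ suc n * (x + s)
  rearrange = solve-∀

-- Zero-sum reduction modulo the total multiplicity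

-- takeMass t hs: the first t units of hs, read as a multiset of unit steps from left to right.
takeMass : ℕ → Vec ℕ n → Vec ℕ n
takeMass t []       = []
takeMass t (h ∷ hs) = (t ⊓ h) ∷ takeMass (t ∸ h) hs

-- For u ≤ v, cutOut u v hs = hs − takeMass v hs + takeMass u hs: the units numbered u + 1, …, v are removed.
cutOut : ℕ → ℕ → Vec ℕ n → Vec ℕ n
cutOut u v []       = []
cutOut u v (h ∷ hs) = (u ⊓ h + (h ∸ v ⊓ h)) ∷ cutOut (u ∸ h) (v ∸ h) hs

m⊓n+[m∸n]⊓o≡m⊓[n+o] : ∀ t h s → t ⊓ h + (t ∸ h) ⊓ s ≡ t ⊓ (h + s)
m⊓n+[m∸n]⊓o≡m⊓[n+o] t h s with ≤-total t h
... | inj₁ t≤h = begin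
  t ⊓ h + (t ∸ h) ⊓ s ≡⟨ cong₂ (λ a b → a + b ⊓ s) (m≤n⇒m⊓n≡m t≤h) (m≤n⇒m∸n≡0 t≤h) ⟩
  t + 0               ≡⟨ +-identityʳ t ⟩
  t                   ≡⟨ m≤n⇒m⊓n≡m (≤-trans t≤h (m≤m+n h s)) ⟨
  t ⊓ (h + s)         ∎
  where open ≡-Reasoning
... | inj₂ h≤t = begin
  t ⊓ h + (t ∸ h) ⊓ s     ≡⟨ cong (_+ (t ∸ h) ⊓ s) (m≥n⇒m⊓n≡n h≤t) ⟩
  h + (t ∸ h) ⊓ s         ≡⟨ +-distribˡ-⊓ h (t ∸ h) s ⟩
  (h + (t ∸ h)) ⊓ (h + s) ≡⟨ cong (_⊓ (h + s)) (m+[n∸m]≡n h≤t) ⟩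
  t ⊓ (h + s)             ∎
  where open ≡-Reasoning

sum-takeMass : (t : ℕ) (hs : Vec ℕ n) → sum (takeMass t hs) ≡ t ⊓ sum hs
sum-takeMass t []       = sym (⊓-zeroʳ t)
sum-takeMass t (h ∷ hs) = trans (cong (t ⊓ h +_) (sum-takeMass (t ∸ h) hs)) (m⊓n+[m∸n]⊓o≡m⊓[n+o] t h (sum hs))

·-takeMass-mono : {u v : ℕ} → u ≤ v → (ws hs : Vec ℕ n) → ws · takeMass u hs ≤ ws · takeMass v hs
·-takeMass-mono u≤v []       []       = ≤-refl
·-takeMass-mono u≤v (w ∷ ws) (h ∷ hs) =
  +-mono-≤ (*-monoʳ-≤ w (⊓-monoˡ-≤ h u≤v)) (·-takeMass-mono (∸-monoˡ-≤ h u≤v) ws hs)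

·-cutOut : (u v : ℕ) (ws hs : Vec ℕ n) →
           ws · cutOut u v hs + ws · takeMass v hs ≡ ws · hs + ws · takeMass u hs
·-cutOut u v []       []       = refl
·-cutOut u v (w ∷ ws) (h ∷ hs) = begin
  w * (u ⊓ h + (h ∸ v ⊓ h)) + ws · cutOut (u ∸ h) (v ∸ h) hs + (w * (v ⊓ h) + ws · takeMass (v ∸ h) hs)
    ≡⟨ interchange (w * (u ⊓ h + (h ∸ v ⊓ h))) _ (w * (v ⊓ h)) _ ⟩
  (w * (u ⊓ h + (h ∸ v ⊓ h)) + w * (v ⊓ h)) + (ws · cutOut (u ∸ h) (v ∸ h) hs + ws · takeMass (v ∸ h) hs)
    ≡⟨ cong₂ _+_ (trans (sym (*-distribˡ-+ w _ (v ⊓ h))) (trans (cong (w *_) units) (*-distribˡ-+ w h (u ⊓ h))))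
                 (·-cutOut (u ∸ h) (v ∸ h) ws hs) ⟩
  (w * h + w * (u ⊓ h)) + (ws · hs + ws · takeMass (u ∸ h) hs)
    ≡⟨ interchange (w * h) (w * (u ⊓ h)) (ws · hs) _ ⟩
  (w * h + ws · hs) + (w * (u ⊓ h) + ws · takeMass (u ∸ h) hs) ∎
  where
  open ≡-Reasoning
  units : u ⊓ h + (h ∸ v ⊓ h) + v ⊓ h ≡ h + u ⊓ h
  units = trans (+-assoc (u ⊓ h) _ _) (trans (cong (u ⊓ h +_) (m∸n+n≡m (m⊓n≤n v h))) (+-comm (u ⊓ h) h))

sum-cutOut : (u v : ℕ) (hs : Vec ℕ n) →
             sum (cutOut u v hs) + sum (takeMass v hs) ≡ sum hs + sum (takeMass u hs)
sum-cutOut {n} u v hs = begin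
  sum (cutOut u v hs) + sum (takeMass v hs) ≡⟨ cong₂ _+_ (replicate-1-· (cutOut u v hs)) (replicate-1-· (takeMass v hs)) ⟨
  1s · cutOut u v hs + 1s · takeMass v hs   ≡⟨ ·-cutOut u v 1s hs ⟩
  1s · hs + 1s · takeMass u hs              ≡⟨ cong₂ _+_ (replicate-1-· hs) (replicate-1-· (takeMass u hs)) ⟩
  sum hs + sum (takeMass u hs)              ∎
  where
  open ≡-Reasoning
  1s = replicate n 1

m%p≡n%p⇒n≡m+p*[n/p∸m/p] : (p : ℕ) .{{_ : NonZero p}} {m n : ℕ} → m ≤ n → m % p ≡ n % p →
                          n ≡ m + p * (n / p ∸ m / p)
m%p≡n%p⇒n≡m+p*[n/p∸m/p] p {m} {n} m≤n m%p≡n%p = begin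
  n                                 ≡⟨ m≡m%n+[m/n]*n n p ⟩
  n % p + n / p * p                 ≡⟨ cong₂ _+_ (sym m%p≡n%p) (cong (_* p) (sym (m+[n∸m]≡n (/-monoˡ-≤ p m≤n)))) ⟩
  m % p + (m / p + (n / p ∸ m / p)) * p ≡⟨ rearrange (m % p) (m / p) (n / p ∸ m / p) p ⟩
  (m % p + m / p * p) + p * (n / p ∸ m / p) ≡⟨ cong (_+ p * (n / p ∸ m / p)) (m≡m%n+[m/n]*n m p) ⟨
  m + p * (n / p ∸ m / p)           ∎
  where
  open ≡-Reasoning
  rearrange : ∀ r a d p → r + (a + d) * p ≡ (r + a * p) + p * d
  rearrange = solve-∀

-- Among the p + 1 initial segments of masses 0, …, p two have weights congruent modulo p;
-- cutting out the units between them lowers the weight by a multiple of p.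
cutOut-step : (p : ℕ) .{{_ : NonZero p}} (ws hs : Vec ℕ n) → p ≤ sum hs →
              ∃ λ hs' → ∃ λ t → sum hs' < sum hs × ws · hs' + p * t ≡ ws · hs
cutOut-step p ws hs p≤∑hs
  with i , j , i<j , same-residue ← pigeonhole (n<1+n p) (λ s → fromℕ< (m%n<n (ws · takeMass (toℕ s) hs) p))
  = cutOut u v hs , t , shorter , lighter
  where
  weight : ℕ → ℕ
  weight s = ws · takeMass s hs
  u = toℕ i
  v = toℕ j
  t = weight v / p ∸ weight u / p
  v≤∑hs : v ≤ sum hs
  v≤∑hs = ≤-trans (≤-pred (toℕ<n j)) p≤∑hs
  takeMass-sum : ∀ {s} → s ≤ sum hs → sum (takeMass s hs) ≡ s
  takeMass-sum s≤∑hs = trans (sum-takeMass _ hs) (m≤n⇒m⊓n≡m s≤∑hs)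
  shorter : sum (cutOut u v hs) < sum hs
  shorter = +-cancelʳ-< v _ _ (begin-strict
    sum (cutOut u v hs) + v ≡⟨ cong (sum (cutOut u v hs) +_) (takeMass-sum v≤∑hs) ⟨
    sum (cutOut u v hs) + sum (takeMass v hs) ≡⟨ sum-cutOut u v hs ⟩
    sum hs + sum (takeMass u hs) ≡⟨ cong (sum hs +_) (takeMass-sum (≤-trans (<⇒≤ i<j) v≤∑hs)) ⟩
    sum hs + u <⟨ +-monoʳ-< (sum hs) i<j ⟩
    sum hs + v ∎)
    where open ≤-Reasoning
  heavier : weight v ≡ weight u + p * t
  heavier = m%p≡n%p⇒n≡m+p*[n/p∸m/p] p (·-takeMass-mono (<⇒≤ i<j) ws hs)
    (trans (sym (toℕ-fromℕ< _)) (trans (cong toℕ same-residue) (toℕ-fromℕ< _)))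
  lighter : ws · cutOut u v hs + p * t ≡ ws · hs
  lighter = +-cancelʳ-≡ (weight u) _ _ (begin
    ws · cutOut u v hs + p * t + weight u   ≡⟨ +-assoc (ws · cutOut u v hs) (p * t) (weight u) ⟩
    ws · cutOut u v hs + (p * t + weight u) ≡⟨ cong (ws · cutOut u v hs +_) (trans (+-comm (p * t) (weight u)) (sym heavier)) ⟩
    ws · cutOut u v hs + weight v           ≡⟨ ·-cutOut u v ws hs ⟩
    ws · hs + weight u                      ∎)
    where open ≡-Reasoning

reduceMass : (p : ℕ) .{{_ : NonZero p}} (ws hs : Vec ℕ n) →
             ∃ λ hs' → ∃ λ t → sum hs' < p × ws · hs' + p * t ≡ ws · hs
reduceMass p ws hs = go hs (<-wellFounded (sum hs))
  where
  go : (hs : Vec ℕ _) → Acc _<_ (sum hs) → ∃ λ hs' → ∃ λ t → sum hs' < p × ws · hs' + p * t ≡ ws · hs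
  go hs (acc smaller) with p ≤? sum hs
  ... | no p≰∑hs = hs , 0 , ≰⇒> p≰∑hs , trans (cong (ws · hs +_) (*-zeroʳ p)) (+-identityʳ (ws · hs))
  ... | yes p≤∑hs
    with hs₁ , t₁ , shorter , eq₁ ← cutOut-step p ws hs p≤∑hs
    with hs₂ , t₂ , small , eq₂ ← go hs₁ (smaller shorter)
    = hs₂ , t₂ + t₁ , small , (begin
      ws · hs₂ + p * (t₂ + t₁)      ≡⟨ cong (ws · hs₂ +_) (*-distribˡ-+ p t₂ t₁) ⟩
      ws · hs₂ + (p * t₂ + p * t₁)  ≡⟨ +-assoc (ws · hs₂) (p * t₂) (p * t₁) ⟨
      ws · hs₂ + p * t₂ + p * t₁    ≡⟨ cong (_+ p * t₁) eq₂ ⟩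
      ws · hs₁ + p * t₁             ≡⟨ eq₁ ⟩
      ws · hs                       ∎)
    where open ≡-Reasoning

-- Reduced solutions and their height

record ReducedSolution (qs : Vec ℕ (suc n)) (x : ℕ) : Set where
  field
    firstGap      : ℕ
    laterGaps     : Vec ℕ n
    value         : qs · fromGaps 0 (firstGap ∷ laterGaps) ≡ x
    laterGaps<sum : sum laterGaps < sum qs

  solution : Vec ℕ (suc n)
  solution = fromGaps 0 (firstGap ∷ laterGaps)

  top : ℕ
  top = last solution

  isGeneralSolution : IsGeneralSolution qs x solution
  isGeneralSolution = linked⇒strictlyIncreasing (fromGaps-linked 0 (firstGap ∷ laterGaps)) , value

-- The first gap has weight sum qs, so the multiple of sum qs cut from the later gaps moves into it.
reduceSolution : {x : ℕ} (qs : Vec ℕ (suc n)) .{{_ : NonZero (sum qs)}} →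
                 HasGeneralSolution qs x → ReducedSolution qs x
reduceSolution {x = x} (q ∷ qs) (F , increasing , F-value)
  with d ∷ hs , refl ← linked⇒fromGaps 0 F (All.universal (λ _ → z≤n) F) (strictlyIncreasing⇒linked F increasing)
  with hs' , t , light , eq ← reduceMass (q + sum qs) (suffixSums qs) hs
  = record { firstGap = d + t ; laterGaps = hs' ; value = value ; laterGaps<sum = light }
  where
  P = q + sum qs
  open ≡-Reasoning
  value : (q ∷ qs) · fromGaps 0 ((d + t) ∷ hs') ≡ x
  value = begin
    (q ∷ qs) · fromGaps 0 ((d + t) ∷ hs')                     ≡⟨ ·-fromGaps 0 (q ∷ qs) ((d + t) ∷ hs') ⟩
    0 * P + (P * (d + t) + suffixSums qs · hs') + baseValue (q ∷ qs)
      ≡⟨ cong (λ z → 0 * P + z + baseValue (q ∷ qs)) (shift P d t (suffixSums qs · hs')) ⟩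
    0 * P + (P * d + (suffixSums qs · hs' + P * t)) + baseValue (q ∷ qs)
      ≡⟨ cong (λ z → 0 * P + (P * d + z) + baseValue (q ∷ qs)) eq ⟩
    0 * P + (P * d + suffixSums qs · hs) + baseValue (q ∷ qs) ≡⟨ ·-fromGaps 0 (q ∷ qs) (d ∷ hs) ⟨
    (q ∷ qs) · fromGaps 0 (d ∷ hs)                            ≡⟨ F-value ⟩
    x                                                         ∎
    where
    shift : ∀ P d t e → P * (d + t) + e ≡ P * d + (e + P * t)
    shift = solve-∀

last*sum≤suffixSums·tail : (qs : Vec ℕ (suc n)) (hs : Vec ℕ n) → last qs * sum hs ≤ suffixSums (tail qs) · hs
last*sum≤suffixSums·tail (q ∷ [])      []       = ≤-reflexive (*-zeroʳ q)
last*sum≤suffixSums·tail (q ∷ q' ∷ qs) (h ∷ hs) = begin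
  last (q' ∷ qs) * (h + sum hs)              ≡⟨ *-distribˡ-+ (last (q' ∷ qs)) h (sum hs) ⟩
  last (q' ∷ qs) * h + last (q' ∷ qs) * sum hs
    ≤⟨ +-mono-≤ (*-monoˡ-≤ h (last≤sum (q' ∷ qs))) (last*sum≤suffixSums·tail (q' ∷ qs) hs) ⟩
  (q' + sum qs) * h + suffixSums qs · hs     ∎
  where open ≤-Reasoning

height-identity : (qs : Vec ℕ (suc n)) (d : ℕ) (hs : Vec ℕ n) →
                  sum qs * last (fromGaps 0 (d ∷ hs)) + baseValue qs + suffixSums (tail qs) · hs
                  ≡ qs · fromGaps 0 (d ∷ hs) + sum qs * n + sum qs * sum hs
height-identity {n} (q ∷ qs) d hs = begin
  P * last (fromGaps 0 (d ∷ hs)) + B + E         ≡⟨ cong (λ z → P * z + B + E) (last-fromGaps 0 (d ∷ hs)) ⟩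
  P * (d + sum hs + n) + B + E                   ≡⟨ rearrange P d (sum hs) n B E ⟩
  0 * P + (P * d + E) + B + P * n + P * sum hs   ≡⟨ cong (λ z → z + P * n + P * sum hs) (·-fromGaps 0 (q ∷ qs) (d ∷ hs)) ⟨
  (q ∷ qs) · fromGaps 0 (d ∷ hs) + P * n + P * sum hs ∎
  where
  open ≡-Reasoning
  P = q + sum qs
  B = baseValue (q ∷ qs)
  E = suffixSums qs · hs
  rearrange : ∀ P d a n B E → P * (d + a + n) + B + E ≡ 0 * P + (P * d + E) + B + P * n + P * a
  rearrange = solve-∀

reduced-height-bound : {x : ℕ} (qs : Vec ℕ (suc n)) (W : ℕ) → sum qs ≡ W + last qs →
                       (R : ReducedSolution qs x) →
                       sum qs * ReducedSolution.top R + baseValue qs ≤ x + sum qs * (n + W)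
reduced-height-bound {n} {x} qs W split R = +-cancelʳ-≤ (w * A) _ _ (begin
  P * top + B + w * A           ≤⟨ +-monoʳ-≤ (P * top + B) (last*sum≤suffixSums·tail qs laterGaps) ⟩
  P * top + B + E               ≡⟨ height-identity qs firstGap laterGaps ⟩
  qs · solution + P * n + P * A ≡⟨ cong₂ (λ y z → y + P * n + z * A) value split ⟩
  x + P * n + (W + w) * A       ≡⟨ distribute x P n W w A ⟩
  x + P * n + W * A + w * A     ≤⟨ +-monoˡ-≤ (w * A) (+-monoʳ-≤ (x + P * n) (*-monoʳ-≤ W (<⇒≤ laterGaps<sum))) ⟩
  x + P * n + W * P + w * A     ≡⟨ collect x P n W (w * A) ⟩
  x + P * (n + W) + w * A       ∎)
  where
  open ReducedSolution R
  open ≤-Reasoning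
  P = sum qs
  B = baseValue qs
  w = last qs
  A = sum laterGaps
  E = suffixSums (tail qs) · laterGaps
  distribute : ∀ x P n W w A → x + P * n + (W + w) * A ≡ x + P * n + W * A + w * A
  distribute = solve-∀
  collect : ∀ x P n W e → x + P * n + W * P + e ≡ x + P * (n + W) + e
  collect = solve-∀

complementSolution : {k x y : ℕ} (qs : Vec ℕ (suc n)) → x + y ≡ sum qs * k →
                     (G : Vec ℕ (suc n)) → IsGeneralSolution (reverse qs) y G → last G ≤ k →
                     HasBoundedGeneralSolution qs k x
complementSolution {k = k} {x} {y} qs x+y≡Pk G@(g ∷ _) (increasing , G-value) G≤k =
  F , (linked⇒strictlyIncreasing (Linked-reverse (complement-linked G≤k′ G<)) , F-value) , F≤k
  where
  G< = strictlyIncreasing⇒linked G increasing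
  G≤k′ = linked-≤-last G< G≤k
  F = reverse (map (k ∸_) G)
  F-value : qs · F ≡ x
  F-value = +-cancelʳ-≡ y _ _ (begin
    qs · F + y                                    ≡⟨ cong₂ _+_ (·-reverse qs (map (k ∸_) G)) (sym G-value) ⟩
    reverse qs · map (k ∸_) G + reverse qs · G   ≡⟨ ·-complement k (reverse qs) G G≤k′ ⟩
    k * sum (reverse qs)                         ≡⟨ cong (k *_) (sum-reverse qs) ⟩
    k * sum qs                                   ≡⟨ *-comm k (sum qs) ⟩
    sum qs * k                                   ≡⟨ x+y≡Pk ⟨
    x + y                                        ∎)
    where open ≡-Reasoning
  F≤k : last F ≤ k
  F≤k = subst (_≤ k) (sym (last-reverse (map (k ∸_) G))) (m∸n≤m k g)

4*P∸2*u∸2*w≡2*U+2*W : {P u U W w : ℕ} → P ≡ u + U → P ≡ W + w → 4 * P ∸ 2 * u ∸ 2 * w ≡ 2 * U + 2 * W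
4*P∸2*u∸2*w≡2*U+2*W {P} {u} {U} {W} {w} P≡u+U P≡W+w = begin
  4 * P ∸ 2 * u ∸ 2 * w                                 ≡⟨ cong (λ z → z ∸ 2 * u ∸ 2 * w) four ⟩
  2 * u + (2 * w + (2 * U + 2 * W)) ∸ 2 * u ∸ 2 * w     ≡⟨ cong (_∸ 2 * w) (m+n∸m≡n (2 * u) _) ⟩
  2 * w + (2 * U + 2 * W) ∸ 2 * w                       ≡⟨ m+n∸m≡n (2 * w) _ ⟩
  2 * U + 2 * W                                         ∎
  where
  open ≡-Reasoning
  double : ∀ P → 4 * P ≡ 2 * P + 2 * P
  double = solve-∀
  regroup : ∀ u U W w → 2 * (u + U) + 2 * (W + w) ≡ 2 * u + (2 * w + (2 * U + 2 * W))
  regroup = solve-∀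
  four : 4 * P ≡ 2 * u + (2 * w + (2 * U + 2 * W))
  four = trans (double P) (trans (cong₂ (λ a b → 2 * a + 2 * b) P≡u+U P≡W+w) (regroup u U W w))

both-tall⇒k+2≤m+U+W : (P : ℕ) .{{_ : NonZero P}} {m U W B B' x y k t t' : ℕ} →
                      P * t + B ≤ x + P * (m + W) → P * t' + B' ≤ y + P * (m + U) →
                      B + B' ≡ m * P → x + y ≡ P * k → k < t → k < t' → k + 2 ≤ m + U + W
both-tall⇒k+2≤m+U+W P {m} {U} {W} {B} {B'} {x} {y} {k} {t} {t'} t-bound t'-bound B+B'≡mP x+y≡Pk k<t k<t' =
  +-cancelʳ-≤ m _ _ (*-cancelˡ-≤ P (+-cancelˡ-≤ (P * k) _ _ (begin
    P * k + P * (k + 2 + m)          ≡⟨ spread P k m ⟩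
    P * (suc k + suc k) + m * P      ≤⟨ +-monoˡ-≤ (m * P) (*-monoʳ-≤ P (+-mono-≤ k<t k<t')) ⟩
    P * (t + t') + m * P             ≡⟨ cong₂ _+_ (*-distribˡ-+ P t t') (sym B+B'≡mP) ⟩
    P * t + P * t' + (B + B')        ≡⟨ interchange (P * t) (P * t') B B' ⟩
    (P * t + B) + (P * t' + B')      ≤⟨ +-mono-≤ t-bound t'-bound ⟩
    x + P * (m + W) + (y + P * (m + U)) ≡⟨ gather x y P m U W ⟩
    x + y + P * (m + U + W + m)      ≡⟨ cong (_+ P * (m + U + W + m)) x+y≡Pk ⟩
    P * k + P * (m + U + W + m)      ∎)))
  where
  open ≤-Reasoning
  spread : ∀ P k m → P * k + P * (k + 2 + m) ≡ P * (suc k + suc k) + m * P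
  spread = solve-∀
  gather : ∀ x y P m U W → x + P * (m + W) + (y + P * (m + U)) ≡ x + y + P * (m + U + W + m)
  gather = solve-∀

k+2≤m+U+W⇒k+m<2*U+2*W : {m U W k : ℕ} → m ≤ U → m ≤ W → k + 2 ≤ m + U + W → k + m < 2 * U + 2 * W
k+2≤m+U+W⇒k+m<2*U+2*W {m} {U} {W} {k} m≤U m≤W k+2≤m+U+W = begin-strict
  k + m               <⟨ m<m+n (k + m) z<s ⟩
  k + m + 2           ≡⟨ +-right-comm k m 2 ⟩
  k + 2 + m           ≤⟨ +-monoˡ-≤ m k+2≤m+U+W ⟩
  m + U + W + m       ≡⟨ reorder m U W ⟩
  m + m + (U + W)     ≤⟨ +-monoˡ-≤ (U + W) (+-mono-≤ m≤U m≤W) ⟩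
  U + W + (U + W)     ≡⟨ twice U W ⟩
  2 * U + 2 * W       ∎
  where
  open ≤-Reasoning
  reorder : ∀ m U W → m + U + W + m ≡ m + m + (U + W)
  reorder = solve-∀
  twice : ∀ U W → U + W + (U + W) ≡ 2 * U + 2 * W
  twice = solve-∀

module _ {m k x y : ℕ} (qs : Vec ℕ (suc (suc m))) (positive : All (1 ≤_) qs)
         (x+y≡Pk : x + y ≡ sum qs * k) where

  private
    P = sum qs
    U = sum (tail qs)
    W = sum (tail (reverse qs))

    P≡W+w : P ≡ W + last qs
    P≡W+w = begin
      P                                         ≡⟨ cong sum (reverse-involutive qs) ⟨
      sum (reverse (reverse qs))                ≡⟨ sum-reverse-split (reverse qs) ⟩
      W + last (reverse (reverse qs))           ≡⟨ cong (λ v → W + last v) (reverse-involutive qs) ⟩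
      W + last qs                               ∎
      where open ≡-Reasoning

    P≡u+U : P ≡ head qs + U
    P≡u+U = sum-head-tail qs

    instance
      P-nonZero : NonZero P
      P-nonZero = >-nonZero (≤-trans (s≤s z≤n) (positive⇒length≤sum positive))
      reverse-P-nonZero : NonZero (sum (reverse qs))
      reverse-P-nonZero = subst NonZero (sym (sum-reverse qs)) P-nonZero

  not-both-tall : 4 * sum qs ∸ 2 * head qs ∸ 2 * last qs ≤ k + suc m →
                  (F : ReducedSolution qs x) (G : ReducedSolution (reverse qs) y) →
                  k < ReducedSolution.top F → k < ReducedSolution.top G → ⊥
  not-both-tall wide F G k<F k<G =
    <⇒≱ (k+2≤m+U+W⇒k+m<2*U+2*W suc-m≤U suc-m≤W
           (both-tall⇒k+2≤m+U+W P {suc m} {U} {W} F-bound G-bound (baseValue-reverse qs) x+y≡Pk k<F k<G))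
        narrow
    where
    suc-m≤U : suc m ≤ U
    suc-m≤U = positive⇒length≤sum (All-tail positive)
    suc-m≤W : suc m ≤ W
    suc-m≤W = positive⇒length≤sum (All-tail (All-reverse positive))
    narrow : 2 * U + 2 * W ≤ k + suc m
    narrow = subst (_≤ k + suc m) (4*P∸2*u∸2*w≡2*U+2*W {P} {head qs} {U} {W} {last qs} P≡u+U P≡W+w) wide
    F-bound : P * ReducedSolution.top F + baseValue qs ≤ x + P * (suc m + W)
    F-bound = reduced-height-bound qs W P≡W+w F
    G-bound : P * ReducedSolution.top G + baseValue (reverse qs) ≤ y + P * (suc m + U)
    G-bound = subst (λ P → P * ReducedSolution.top G + baseValue (reverse qs) ≤ y + P * (suc m + U)) (sum-reverse qs)
                (reduced-height-bound (reverse qs) U (sum-reverse-split qs) G)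

  bounded-unless-both-tall : (F : ReducedSolution qs x) (G : ReducedSolution (reverse qs) y) →
                             (k < ReducedSolution.top F → k < ReducedSolution.top G → ⊥) →
                             HasBoundedGeneralSolution qs k x
  bounded-unless-both-tall F G not-both
    with ReducedSolution.top F ≤? k | ReducedSolution.top G ≤? k
  ... | yes F≤k | _       = ReducedSolution.solution F , ReducedSolution.isGeneralSolution F , F≤k
  ... | no _    | yes G≤k = complementSolution qs x+y≡Pk (ReducedSolution.solution G) (ReducedSolution.isGeneralSolution G) G≤k
  ... | no F≰k  | no G≰k  = ⊥-elim (not-both (≰⇒> F≰k) (≰⇒> G≰k))

  boundedSolution : 4 * sum qs ∸ 2 * head qs ∸ 2 * last qs ≤ k + suc m →
                    HasGeneralSolution qs x → HasGeneralSolution (reverse qs) y →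
                    HasBoundedGeneralSolution qs k x
  boundedSolution wide x-solution y-solution =
    bounded-unless-both-tall F G (not-both-tall wide F G)
    where
    F = reduceSolution qs x-solution
    G = reduceSolution (reverse qs) y-solution

-- Dividing by the gcd

gcdVec-∣ : (v : Vec ℕ n) → All (gcdVec v ∣_) v
gcdVec-∣ []      = []
gcdVec-∣ (x ∷ v) = gcd[m,n]∣m x (gcdVec v) ∷ All.map (∣-trans (gcd[m,n]∣n x (gcdVec v))) (gcdVec-∣ v)

∣-gcdVec : {d : ℕ} {v : Vec ℕ n} → All (d ∣_) v → d ∣ gcdVec v
∣-gcdVec []          = _ ∣0
∣-gcdVec (d∣x ∷ d∣v) = gcd-greatest d∣x (∣-gcdVec d∣v)

gcdVec-reverse-∣ : (v : Vec ℕ n) → gcdVec (reverse v) ∣ gcdVec v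
gcdVec-reverse-∣ v = ∣-gcdVec (subst (All _) (reverse-involutive v) (All-reverse (gcdVec-∣ (reverse v))))

all-∣⇒map-* : {c : ℕ} {v : Vec ℕ n} → All (c ∣_) v → ∃ λ qs → v ≡ map (_* c) qs
all-∣⇒map-* []                    = [] , refl
all-∣⇒map-* (divides q refl ∷ c∣v) with qs , refl ← all-∣⇒map-* c∣v = q ∷ qs , refl

divisor-nonZero : {d n : ℕ} → d ∣ n → 1 ≤ n → NonZero d
divisor-nonZero {zero}  0∣n 1≤n = contradiction (0∣⇒≡0 0∣n) (≢-nonZero⁻¹ _ {{>-nonZero 1≤n}})
divisor-nonZero {suc d} _   _   = _

positive-scale⁻ : {c : ℕ} {qs : Vec ℕ n} → All (1 ≤_) (map (_* c) qs) → All (1 ≤_) qs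
positive-scale⁻ {c = c} positive = All.map factor-positive (All.map⁻ positive)
  where
  factor-positive : {q : ℕ} → 1 ≤ q * c → 1 ≤ q
  factor-positive {suc q} _ = s≤s z≤n

hasGeneralSolution-scale⁻ : {c x : ℕ} .{{_ : NonZero c}} {qs : Vec ℕ n} →
  HasGeneralSolution (map (_* c) qs) (x * c) → HasGeneralSolution qs x
hasGeneralSolution-scale⁻ {c = c} {qs = qs} (fs , increasing , value) =
  fs , increasing , *-cancelʳ-≡ _ _ c (trans (sym (map-*-· c qs fs)) value)

hasBoundedGeneralSolution-scale⁺ : {c k x : ℕ} {qs : Vec ℕ (suc n)} →
  HasBoundedGeneralSolution qs k x → HasBoundedGeneralSolution (map (_* c) qs) k (x * c)
hasBoundedGeneralSolution-scale⁺ {c = c} {qs = qs} (fs , (increasing , value) , bounded) =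
  fs , (increasing , trans (map-*-· c qs fs) (cong (_* c) value)) , bounded

*-distribʳ-4∸2∸2 : ∀ c P u w → (4 * P ∸ 2 * u ∸ 2 * w) * c ≡ 4 * (P * c) ∸ 2 * (u * c) ∸ 2 * (w * c)
*-distribʳ-4∸2∸2 c P u w = begin
  (4 * P ∸ 2 * u ∸ 2 * w) * c           ≡⟨ *-distribʳ-∸ c (4 * P ∸ 2 * u) (2 * w) ⟩
  (4 * P ∸ 2 * u) * c ∸ 2 * w * c       ≡⟨ cong (_∸ 2 * w * c) (*-distribʳ-∸ c (4 * P) (2 * u)) ⟩
  4 * P * c ∸ 2 * u * c ∸ 2 * w * c     ≡⟨ cong₂ _∸_ (cong₂ _∸_ (*-assoc 4 P c) (*-assoc 2 u c)) (*-assoc 2 w c) ⟩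
  4 * (P * c) ∸ 2 * (u * c) ∸ 2 * (w * c) ∎
  where open ≡-Reasoning

width-scale⁻ : {c k : ℕ} .{{_ : NonZero c}} (qs : Vec ℕ (suc n)) →
  let ps = map (_* c) qs in
  4 * sum ps ∸ 2 * head ps ∸ 2 * last ps + c ≤ c * (k + suc n) →
  4 * sum qs ∸ 2 * head qs ∸ 2 * last qs ≤ k + n
width-scale⁻ {n} {c} {k} qs@(u ∷ _) wide = ≤-pred (*-cancelʳ-≤ _ _ c (begin
  suc (4 * P ∸ 2 * u ∸ 2 * w) * c                   ≡⟨ +-comm c _ ⟩
  (4 * P ∸ 2 * u ∸ 2 * w) * c + c                   ≡⟨ cong (_+ c) (*-distribʳ-4∸2∸2 c P u w) ⟩
  4 * (P * c) ∸ 2 * (u * c) ∸ 2 * (w * c) + c       ≡⟨ cong₂ (λ a b → 4 * a ∸ 2 * (u * c) ∸ 2 * b + c) (sum-map-* c qs) (last-map (_* c) qs) ⟨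
  4 * sum ps ∸ 2 * head ps ∸ 2 * last ps + c        ≤⟨ wide ⟩
  c * (k + suc n)                                   ≡⟨ *-comm c (k + suc n) ⟩
  (k + suc n) * c                                   ≡⟨ cong (_* c) (+-suc k n) ⟩
  suc (k + n) * c                                   ∎))
  where
  open ≤-Reasoning
  ps = map (_* c) qs
  P = sum qs
  w = last qs

scaledCount : {c k x : ℕ} {ps qs : Vec ℕ n} → ps ≡ map (_* c) qs → sum ps * k ∸ x * c ≡ (sum qs * k ∸ x) * c
scaledCount {c = c} {k} {x} {qs = qs} refl = begin
  sum (map (_* c) qs) * k ∸ x * c ≡⟨ cong (λ s → s * k ∸ x * c) (sum-map-* c qs) ⟩
  sum qs * c * k ∸ x * c          ≡⟨ cong (_∸ x * c) (*-right-comm (sum qs) c k) ⟩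
  sum qs * k * c ∸ x * c          ≡⟨ *-distribʳ-∸ c (sum qs * k) x ⟨
  (sum qs * k ∸ x) * c            ∎
  where open ≡-Reasoning

boundedSolution-scaled : {m c k x : ℕ} .{{_ : NonZero c}} (ps qs : Vec ℕ (suc (suc m))) → ps ≡ map (_* c) qs →
  All (1 ≤_) ps → 4 * sum ps ∸ 2 * head ps ∸ 2 * last ps + c ≤ c * (k + suc (suc m)) → x * c ≤ sum ps * k →
  HasGeneralSolution ps (x * c) → HasGeneralSolution (reverse ps) (sum ps * k ∸ x * c) →
  HasBoundedGeneralSolution ps k (x * c)
boundedSolution-scaled {c = c} {k} {x} _ qs refl positive wide x*c≤Pk x-solution y-solution =
  hasBoundedGeneralSolution-scale⁺ {qs = qs}
    (boundedSolution qs (positive-scale⁻ positive) (m+[n∸m]≡n x≤Qk) (width-scale⁻ qs wide)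
      (hasGeneralSolution-scale⁻ {x = x} {qs = qs} x-solution)
      (hasGeneralSolution-scale⁻ {x = sum qs * k ∸ x} {qs = reverse qs}
        (subst₂ HasGeneralSolution (sym (map-reverse (_* c) qs)) (scaledCount {k = k} {x} {qs = qs} refl) y-solution)))
  where
  x≤Qk : x ≤ sum qs * k
  x≤Qk = *-cancelʳ-≤ x _ c (subst (x * c ≤_) (trans (cong (_* k) (sum-map-* c qs)) (*-right-comm (sum qs) c k)) x*c≤Pk)

mainTheorem1 : (m : ℕ) → 1 ≤ m → (ps : Multiplicities (suc m)) → ValidMultiplicities ps →
    (γ γ' : ℕ) → IsGamma ps γ → IsGamma (reverseSeq ps) γ' →
    (k : ℕ) →
    ((4 * seqLength ps ∸ 2 * head ps ∸ 2 * last ps) + gcdVec ps ≤ gcdVec ps * (k + suc m)) →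
    (f : ℕ) → gcdVec ps ∣ f → γ < f → f + γ' < seqLength ps * k →
    HasBoundedGeneralSolution ps k f
mainTheorem1 zero    ()
mainTheorem1 (suc m) _ ps valid γ γ' (_ , γ-property , _) (_ , γ'-property , _) k wide _ c∣f@(divides x refl) γ<f f+γ'<Pk =
  boundedSolution-scaled {x = x} ps qs ps≡qs*c (All.lookup⁻ valid) wide (≤-trans (m≤m+n (x * c) γ') (<⇒≤ f+γ'<Pk))
    (γ-property (x * c) c∣f γ<f)
    (γ'-property (sum ps * k ∸ x * c) (∣-trans (gcdVec-reverse-∣ ps) (divides (sum qs * k ∸ x) (scaledCount {k = k} {x} ps≡qs*c))) γ'<Pk∸f)
  where
  c = gcdVec ps
  qs = proj₁ (all-∣⇒map-* (gcdVec-∣ ps))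
  ps≡qs*c : ps ≡ map (_* c) qs
  ps≡qs*c = proj₂ (all-∣⇒map-* (gcdVec-∣ ps))
  instance
    c-nonZero : NonZero c
    c-nonZero = divisor-nonZero (All.lookup⁺ (gcdVec-∣ ps) zero) (valid zero)
  γ'<Pk∸f : γ' < sum ps * k ∸ x * c
  γ'<Pk∸f = m+n≤o⇒m≤o∸n (suc γ') (subst (_≤ sum ps * k) (cong suc (+-comm (x * c) γ')) f+γ'<Pk)
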